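{- $d_0(P_2)=\Gamma_t(P_2)=d_0(P_4)=\Gamma_t(P_4)=2$, and $d_0(P_n)=\Gamma_t(P_n)+1$ if $n=3$ or $n\geq 5$.
   Context: $P_n$ is the path on $n$ vertices. A total dominating set (TDS) of a graph without isolated vertices is a vertex set $S$ such that every vertex is adjacent to a vertex of $S$; a minimal TDS is a TDS no proper subset of which is a TDS; $\Gamma_t(G)$ is the maximum cardinality of a minimal TDS. For a positive integer $k$, $D_k^t(G)$ is the graph whose vertices are the TDSs of $G$ of cardinality at most $k$, two being adjacent if and only if one is obtained from the other by adding or deleting a single vertex. $d_0(G)$ is the smallest integer $\ell$ such that $D_k^t(G)$ is connected for all $k\geq\ell$. -}

module Defs where

open import Data.Nat using (ℕ; zero; suc; _≤_)
open import Data.Fin using (Fin; toℕ)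
open import Data.Fin.Subset using (Subset; _∈_; _∉_; _⊂_; ∣_∣)
open import Data.Vec using (lookup)
open import Data.Product using (Σ; ∃; _×_; _,_)
open import Data.Sum using (_⊎_)
open import Relation.Nullary using (¬_)
open import Relation.Binary.PropositionalEquality using (_≡_; _≢_)
open import Relation.Binary.Construct.Closure.ReflexiveTransitive using (Star)

record Graph : Set₁ where
  field
    order : ℕ
    Adj   : Fin order → Fin order → Set

open Graph public

P : ℕ → Graph
P n = record { order = n ; Adj = λ i j → (toℕ j ≡ suc (toℕ i)) ⊎ (toℕ i ≡ suc (toℕ j)) }

IsTDS : (G : Graph) → Subset (order G) → Set
IsTDS G S = ∀ v → ∃ λ u → u ∈ S × Adj G v u

IsMinimalTDS : (G : Graph) → Subset (order G) → Set
IsMinimalTDS G S = IsTDS G S × (∀ T → T ⊂ S → ¬ IsTDS G T)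

IsUpperTotalDom : (G : Graph) → ℕ → Set
IsUpperTotalDom G m =
  (∃ λ S → IsMinimalTDS G S × ∣ S ∣ ≡ m) × (∀ S → IsMinimalTDS G S → ∣ S ∣ ≤ m)

IsDVertex : (G : Graph) → ℕ → Subset (order G) → Set
IsDVertex G k S = IsTDS G S × ∣ S ∣ ≤ k

-- T is obtained from S by adding or deleting a single vertex
-- (S and T differ in exactly one coordinate).
OneStep : {n : ℕ} → Subset n → Subset n → Set
OneStep S T = ∃ λ v → (lookup S v ≢ lookup T v) × (∀ w → w ≢ v → lookup S w ≡ lookup T w)

DEdge : (G : Graph) → ℕ → Subset (order G) → Subset (order G) → Set
DEdge G k S T = IsDVertex G k S × IsDVertex G k T × OneStep S T

DConnected : (G : Graph) → ℕ → Set
DConnected G k =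
  (∃ λ S → IsDVertex G k S) ×
  (∀ S T → IsDVertex G k S → IsDVertex G k T → Star (DEdge G k) S T)

IsD0 : (G : Graph) → ℕ → Set
IsD0 G ℓ =
  (∀ k → 1 ≤ k → ℓ ≤ k → DConnected G k) ×
  (∀ ℓ' → (∀ k → 1 ≤ k → ℓ' ≤ k → DConnected G k) → ℓ ≤ ℓ')

module Submission where

-- Let g n = 2⌊(n+1)/3⌋, i.e. g 0 = g 1 = 0, g 2 = 2 and g (n+3) = 2 + g n.
-- All reasoning about a vertex set S of P_n is done on its characteristic
-- function ⟦ S ⟧ : ℕ → Bool, where total domination reads
-- "every v < n has S(v+1) or S(v-1)" and minimality reads "no vertex of S
-- can be deleted" (both shown equivalent to the definitions in Defs).
--
-- 1. Γ_t(P_n) = g n.  Upper bound: for a minimal TDS S the complement of S,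
--    shifted by one and padded with the two end points 0 and n+1, dominates
--    {0,…,n+1} in the graph q ~ q ± 2; this graph is two paths (even and odd
--    positions) and a dominating set of an m-vertex path has ≥ m/3 vertices.
--    Lower bound: an explicit period-3 pattern (110110… or 011011…).
-- 2. D_k(P_n) is connected for k ≥ g n + 1: sweeping from left to right, every
--    TDS of size ≤ k is moved to one canonical TDS S*, fixing one position at
--    a time; when neither deletion nor a swap is possible the set has size
--    k > Γ_t, so it has a deletable vertex, which shrinks it.
-- 3. D_{g n}(P_n) is disconnected for n = 3 and n ≥ 5: the extremal minimal
--    TDS is an isolated vertex, while another TDS of size ≤ g n exists.
-- 4. For n = 2, 4 there is a unique TDS of size ≤ 2 = g n, and D_1 is empty.

open import Defs
open import Data.Nat using (ℕ; zero; suc; _+_; _*_; _≤_; _<_; z≤n; s≤s; _≟_; _<?_; _≤?_; _≡ᵇ_)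
open import Data.Nat.Properties
open import Data.Nat.Tactic.RingSolver using (solve-∀)
open import Data.Bool using (Bool; true; false; not; _∧_; _∨_)
open import Data.Bool.Properties using (∨-zeroʳ; ¬-not) renaming (_≟_ to _≟ᴮ_)
open import Data.Fin using (Fin; toℕ; fromℕ<) renaming (zero to fzero; suc to fsuc; _≟_ to _≟ᶠ_)
open import Data.Fin.Properties using (toℕ-fromℕ<; toℕ-injective; toℕ<n) renaming (suc-injective to fsuc-injective)
open import Data.Fin.Subset using (Subset; _∈_; _⊂_; _⊆_; ∣_∣)
open import Data.Fin.Subset.Properties using (∣p∣≤n)
open import Data.Vec using ([]; _∷_; lookup)
open import Data.Vec.Properties using ([]=⇒lookup; lookup⇒[]=; tabulate∘lookup; tabulate-cong)
open import Data.Product using (Σ; ∃; _×_; _,_; proj₁; proj₂)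
open import Data.Sum using (_⊎_; inj₁; inj₂)
open import Data.Empty using (⊥; ⊥-elim)
open import Relation.Nullary using (¬_; Dec; yes; no; does; contradiction)
open import Relation.Nullary.Decidable using (map′; ¬?; _×-dec_)
open import Relation.Binary.Definitions using (tri<; tri≈; tri>)
open import Relation.Binary.PropositionalEquality
open import Relation.Binary.Construct.Closure.ReflexiveTransitive using (Star; ε; _◅_; _◅◅_; reverse)

bit : Bool → ℕ
bit true = 1
bit false = 0

true≢false : true ≢ false
true≢false ()

∨-introˡ : ∀ {a} b → a ≡ true → a ∨ b ≡ true
∨-introˡ b refl = refl

∨-introʳ : ∀ a {b} → b ≡ true → a ∨ b ≡ true
∨-introʳ a refl = ∨-zeroʳ a

∨-elim : ∀ a b → a ∨ b ≡ true → a ≡ true ⊎ b ≡ true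
∨-elim true b _ = inj₁ refl
∨-elim false b e = inj₂ e

∧-elim : ∀ a b → a ∧ b ≡ true → a ≡ true × b ≡ true
∧-elim true true _ = refl , refl

∧-false : ∀ a b → a ∧ b ≡ false → a ≡ false ⊎ b ≡ false
∧-false false b _ = inj₁ refl
∧-false true b e = inj₂ e

≢true : ∀ {b} → b ≢ true → b ≡ false
≢true = ¬-not

not≡false : ∀ {b} → not b ≡ false → b ≡ true
not≡false {true} _ = refl

not≡true : ∀ {b} → not b ≡ true → b ≡ false
not≡true {false} _ = refl

does-true : ∀ {A : Set} (d : Dec A) → does d ≡ true → A
does-true (yes a) _ = a

does-false : ∀ {A : Set} (d : Dec A) → does d ≡ false → ¬ A
does-false (no ¬a) _ = ¬a

⟦_⟧ : ∀ {n} → Subset n → ℕ → Bool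
⟦ [] ⟧ _ = false
⟦ x ∷ S ⟧ zero = x
⟦ x ∷ S ⟧ (suc i) = ⟦ S ⟧ i

lookup≡⟦⟧ : ∀ {n} (S : Subset n) (i : Fin n) → lookup S i ≡ ⟦ S ⟧ (toℕ i)
lookup≡⟦⟧ (x ∷ S) fzero = refl
lookup≡⟦⟧ (x ∷ S) (fsuc i) = lookup≡⟦⟧ S i

⟦⟧-beyond : ∀ {n} (S : Subset n) {i} → n ≤ i → ⟦ S ⟧ i ≡ false
⟦⟧-beyond [] _ = refl
⟦⟧-beyond (x ∷ S) (s≤s p) = ⟦⟧-beyond S p

⟦⟧-true⇒< : ∀ {n} (S : Subset n) i → ⟦ S ⟧ i ≡ true → i < n
⟦⟧-true⇒< (x ∷ S) zero _ = s≤s z≤n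
⟦⟧-true⇒< (x ∷ S) (suc i) e = s≤s (⟦⟧-true⇒< S i e)

∈⇒⟦⟧ : ∀ {n} (S : Subset n) {i : Fin n} → i ∈ S → ⟦ S ⟧ (toℕ i) ≡ true
∈⇒⟦⟧ S {i} i∈S = trans (sym (lookup≡⟦⟧ S i)) ([]=⇒lookup i∈S)

⟦⟧⇒∈ : ∀ {n} (S : Subset n) (i : Fin n) → ⟦ S ⟧ (toℕ i) ≡ true → i ∈ S
⟦⟧⇒∈ S i e = lookup⇒[]= i S (trans (lookup≡⟦⟧ S i) e)

⟦⟧⇒∈′ : ∀ {n} (S : Subset n) i (e : ⟦ S ⟧ i ≡ true) → fromℕ< (⟦⟧-true⇒< S i e) ∈ S
⟦⟧⇒∈′ S i e = ⟦⟧⇒∈ S _ (trans (cong ⟦ S ⟧ (toℕ-fromℕ< (⟦⟧-true⇒< S i e))) e)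

⟦⟧-injective : ∀ {n} (S U : Subset n) → (∀ i → i < n → ⟦ S ⟧ i ≡ ⟦ U ⟧ i) → S ≡ U
⟦⟧-injective [] [] _ = refl
⟦⟧-injective (x ∷ S) (y ∷ U) h =
  cong₂ _∷_ (h 0 (s≤s z≤n)) (⟦⟧-injective S U (λ i p → h (suc i) (s≤s p)))

fromFun : (n : ℕ) → (ℕ → Bool) → Subset n
fromFun zero f = []
fromFun (suc n) f = f 0 ∷ fromFun n (λ i → f (suc i))

⟦fromFun⟧ : ∀ n f {i} → i < n → ⟦ fromFun n f ⟧ i ≡ f i
⟦fromFun⟧ (suc n) f {zero} _ = refl
⟦fromFun⟧ (suc n) f {suc i} (s≤s p) = ⟦fromFun⟧ n (λ i → f (suc i)) p

⟦fromFun⟧-false : ∀ n f i → f i ≡ false → ⟦ fromFun n f ⟧ i ≡ false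
⟦fromFun⟧-false n f i e with i <? n
... | yes i<n = trans (⟦fromFun⟧ n f i<n) e
... | no i≮n = ⟦⟧-beyond (fromFun n f) (≮⇒≥ i≮n)

-- S with its i-th coordinate set to b (unchanged if i ≥ n).
update : ∀ {n} → Subset n → ℕ → Bool → Subset n
update [] p b = []
update (x ∷ S) zero b = b ∷ S
update (x ∷ S) (suc p) b = x ∷ update S p b

update-same : ∀ {n} (S : Subset n) {p} b → p < n → ⟦ update S p b ⟧ p ≡ b
update-same (x ∷ S) {zero} b _ = refl
update-same (x ∷ S) {suc p} b (s≤s q) = update-same S b q

update-other : ∀ {n} (S : Subset n) p b i → i ≢ p → ⟦ update S p b ⟧ i ≡ ⟦ S ⟧ i
update-other [] p b i _ = refl
update-other (x ∷ S) zero b zero i≢p = contradiction refl i≢p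
update-other (x ∷ S) zero b (suc i) _ = refl
update-other (x ∷ S) (suc p) b zero _ = refl
update-other (x ∷ S) (suc p) b (suc i) i≢p = update-other S p b i (λ e → i≢p (cong suc e))

∣update-true∣ : ∀ {n} (S : Subset n) {p} → ⟦ S ⟧ p ≡ false → p < n → ∣ update S p true ∣ ≡ suc ∣ S ∣
∣update-true∣ (false ∷ S) {zero} _ _ = refl
∣update-true∣ (true ∷ S) {suc p} e (s≤s q) = cong suc (∣update-true∣ S e q)
∣update-true∣ (false ∷ S) {suc p} e (s≤s q) = ∣update-true∣ S e q

∣update-false∣ : ∀ {n} (S : Subset n) {p} → ⟦ S ⟧ p ≡ true → suc ∣ update S p false ∣ ≡ ∣ S ∣
∣update-false∣ (true ∷ S) {zero} _ = refl
∣update-false∣ (true ∷ S) {suc p} e = cong suc (∣update-false∣ S e)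
∣update-false∣ (false ∷ S) {suc p} e = ∣update-false∣ S e

count : ℕ → (ℕ → Bool) → ℕ
count zero f = 0
count (suc n) f = bit (f 0) + count n (λ i → f (suc i))

∣fromFun∣ : ∀ n f → ∣ fromFun n f ∣ ≡ count n f
∣fromFun∣ zero f = refl
∣fromFun∣ (suc n) f with f 0
... | true = cong suc (∣fromFun∣ n (λ i → f (suc i)))
... | false = ∣fromFun∣ n (λ i → f (suc i))

-- s (v - 1); vertex 0 has no left neighbour.
leftOf : (ℕ → Bool) → ℕ → Bool
leftOf s zero = false
leftOf s (suc u) = s u

hasNeighbour : (ℕ → Bool) → ℕ → Bool
hasNeighbour s v = s (suc v) ∨ leftOf s v

TotDom : ℕ → (ℕ → Bool) → Set
TotDom n s = ∀ v → v < n → hasNeighbour s v ≡ true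

isTDS⇒TotDom : ∀ {n} (S : Subset n) → IsTDS (P n) S → TotDom n ⟦ S ⟧
isTDS⇒TotDom S tds v v<n with tds (fromℕ< v<n)
... | u , u∈S , inj₁ u≡v+1 =
  ∨-introˡ _ (subst (λ i → ⟦ S ⟧ i ≡ true) (trans u≡v+1 (cong suc (toℕ-fromℕ< v<n))) (∈⇒⟦⟧ S u∈S))
... | u , u∈S , inj₂ v≡u+1 rewrite toℕ-fromℕ< v<n | v≡u+1 = ∨-introʳ _ (∈⇒⟦⟧ S u∈S)

TotDom⇒isTDS : ∀ {n} (S : Subset n) → TotDom n ⟦ S ⟧ → IsTDS (P n) S
TotDom⇒isTDS {n} S td v with ∨-elim _ _ (td (toℕ v) (toℕ<n v))
... | inj₁ e = _ , ⟦⟧⇒∈′ S _ e , inj₁ (toℕ-fromℕ< (⟦⟧-true⇒< S _ e))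
... | inj₂ e = leftNeighbour (toℕ v) refl e
  where
  leftNeighbour : ∀ m → toℕ v ≡ m → leftOf ⟦ S ⟧ m ≡ true → ∃ λ u → u ∈ S × Adj (P n) v u
  leftNeighbour (suc u) v≡u+1 e′ =
    _ , ⟦⟧⇒∈′ S u e′ , inj₂ (trans v≡u+1 (cong suc (sym (toℕ-fromℕ< (⟦⟧-true⇒< S u e′)))))

totDom? : ∀ n s → Dec (TotDom n s)
totDom? n s = map′ (λ h v v<n → h v<n) (λ h {v} v<n → h v v<n) (allUpTo? (λ v → hasNeighbour s v ≟ᴮ true) n)

TotDom-mono : ∀ {n s s′} → TotDom n s → (∀ i → s i ≡ true → s′ i ≡ true) → TotDom n s′
TotDom-mono {s = s} {s′} td s⊆s′ v v<n with ∨-elim _ _ (td v v<n)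
... | inj₁ e = ∨-introˡ _ (s⊆s′ _ e)
... | inj₂ e = ∨-introʳ _ (left v e)
  where
  left : ∀ v → leftOf s v ≡ true → leftOf s′ v ≡ true
  left (suc u) e = s⊆s′ u e

undominated : ∀ {n s} v → v < n → s (suc v) ≡ false → leftOf s v ≡ false → ¬ TotDom n s
undominated {s = s} v v<n right left td with td v v<n
... | h rewrite right | left = true≢false (sym h)

TotDom⇒2≤∣∣ : ∀ {n} (S : Subset (suc n)) → TotDom (suc n) ⟦ S ⟧ → 2 ≤ ∣ S ∣
TotDom⇒2≤∣∣ S td = go S td (td 0 (s≤s z≤n))
  where
  go : ∀ {m} (S : Subset (suc m)) → TotDom (suc m) ⟦ S ⟧ → hasNeighbour ⟦ S ⟧ 0 ≡ true → 2 ≤ ∣ S ∣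
  go (x ∷ []) td ()
  go (x ∷ false ∷ S) td ()
  go (true ∷ true ∷ S) td _ = s≤s (s≤s z≤n)
  go (false ∷ true ∷ true ∷ S) td _ = s≤s (s≤s z≤n)
  go (false ∷ true ∷ false ∷ S) td _ with td 1 (s≤s (s≤s z≤n))
  ... | ()
  go (false ∷ true ∷ []) td _ with td 1 (s≤s (s≤s z≤n))
  ... | ()

r≢2+r : ∀ r → r ≢ suc (suc r)
r≢2+r zero ()
r≢2+r (suc r) e = r≢2+r r (suc-injective e)

-- Deleting vertex p keeps total domination when its two neighbours keep a
-- neighbour: p - 1 is dominated by p - 2 (or does not exist) and p + 1 is
-- dominated by p + 2 (or does not exist).
LeftCovered : (ℕ → Bool) → ℕ → Set
LeftCovered s p = p ≡ 0 ⊎ Σ ℕ λ r → p ≡ suc (suc r) × s r ≡ true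

RightCovered : ℕ → (ℕ → Bool) → ℕ → Set
RightCovered n s p = n ≤ suc p ⊎ s (suc (suc p)) ≡ true

deletion-safe : ∀ n s s′ p → TotDom n s → (∀ i → i ≢ p → s′ i ≡ s i) → s′ p ≡ false →
                LeftCovered s p → RightCovered n s p → TotDom n s′
deletion-safe n s s′ p td same _ left right v v<n with suc v ≟ p | v ≟ suc p
... | yes v+1≡p | _ with left
...   | inj₁ p≡0 = contradiction (trans v+1≡p p≡0) 1+n≢0
...   | inj₂ (r , p≡r+2 , sr) with suc-injective (trans v+1≡p p≡r+2)
...     | refl = ∨-introʳ _ (trans (same r (λ q → r≢2+r r (trans q p≡r+2))) sr)
deletion-safe n s s′ p td same _ left right v v<n | no v+1≢p | yes v≡p+1 with right
... | inj₁ n≤p+1 = contradiction (subst (n ≤_) (sym v≡p+1) n≤p+1) (<⇒≱ v<n)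
... | inj₂ sp+2 = ∨-introˡ _ (trans (same (suc v) v+1≢p) (subst (λ x → s (suc x) ≡ true) (sym v≡p+1) sp+2))
deletion-safe n s s′ p td same _ left right v v<n | no v+1≢p | no v≢p+1 =
  subst (_≡ true) (sym (cong₂ _∨_ (same (suc v) v+1≢p) (leftOf-same v v≢p+1))) (td v v<n)
  where
  leftOf-same : ∀ v → v ≢ suc p → leftOf s′ v ≡ leftOf s v
  leftOf-same zero _ = refl
  leftOf-same (suc u) h = same u (λ q → h (cong suc q))

Irredundant : ∀ {n} → Subset n → Set
Irredundant {n} S = ∀ p → ⟦ S ⟧ p ≡ true → ¬ TotDom n ⟦ update S p false ⟧

-- For total dominating sets, irredundance is exactly minimality: a proper
-- subset misses some vertex x, so it lies inside S with x deleted.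
irredundant⇒minimal : ∀ {n} (S : Subset n) → TotDom n ⟦ S ⟧ → Irredundant S → IsMinimalTDS (P n) S
irredundant⇒minimal {n} S td irr = TotDom⇒isTDS S td , noSmaller
  where
  noSmaller : ∀ T → T ⊂ S → ¬ IsTDS (P n) T
  noSmaller T (T⊆S , x , x∈S , x∉T) tdsT =
    irr (toℕ x) (∈⇒⟦⟧ S x∈S) (TotDom-mono (isTDS⇒TotDom T tdsT) inside)
    where
    inside : ∀ i → ⟦ T ⟧ i ≡ true → ⟦ update S (toℕ x) false ⟧ i ≡ true
    inside i e with i ≟ toℕ x
    ... | yes refl = contradiction (⟦⟧⇒∈ T x e) x∉T
    ... | no i≢x = trans (update-other S (toℕ x) false i i≢x)
                         (subst (λ j → ⟦ S ⟧ j ≡ true) (toℕ-fromℕ< (⟦⟧-true⇒< T i e)) (∈⇒⟦⟧ S (T⊆S (⟦⟧⇒∈′ T i e))))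

minimal⇒irredundant : ∀ {n} (S : Subset n) → IsMinimalTDS (P n) S → Irredundant S
minimal⇒irredundant {n} S (_ , noSmaller) p e td′ =
  noSmaller S′ (S′⊆S , _ , ⟦⟧⇒∈′ S p e , λ x∈S′ → true≢false (trans (sym (∈⇒⟦⟧ S′ x∈S′)) deleted))
            (TotDom⇒isTDS S′ td′)
  where
  S′ : Subset n
  S′ = update S p false
  p<n : p < n
  p<n = ⟦⟧-true⇒< S p e
  deleted : ⟦ S′ ⟧ (toℕ (fromℕ< p<n)) ≡ false
  deleted = trans (cong ⟦ S′ ⟧ (toℕ-fromℕ< p<n)) (update-same S false p<n)
  S′⊆S : S′ ⊆ S
  S′⊆S {x} x∈S′ with toℕ x ≟ p
  ... | yes refl = contradiction (trans (sym (∈⇒⟦⟧ S′ x∈S′)) (update-same S false p<n)) true≢false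
  ... | no x≢p = ⟦⟧⇒∈ S x (trans (sym (update-other S p false (toℕ x) x≢p)) (∈⇒⟦⟧ S′ x∈S′))

Deletable : ∀ {n} → Subset n → ℕ → Set
Deletable {n} S p = ⟦ S ⟧ p ≡ true × TotDom n ⟦ update S p false ⟧

deletable? : ∀ {n} (S : Subset n) p → Dec (Deletable S p)
deletable? {n} S p with ⟦ S ⟧ p ≟ᴮ true | totDom? n ⟦ update S p false ⟧
... | yes a | yes b = yes (a , b)
... | no ¬a | _ = no (λ d → ¬a (proj₁ d))
... | yes _ | no ¬b = no (λ d → ¬b (proj₂ d))

deletable-or-irredundant : ∀ {n} (S : Subset n) → (∃ λ p → p < n × Deletable S p) ⊎ Irredundant S
deletable-or-irredundant {n} S with anyUpTo? (deletable? S) n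
... | yes d = inj₁ d
... | no none = inj₂ λ p e td′ → none (p , ⟦⟧-true⇒< S p e , e , td′)

-- Every total dominating set contains an irredundant one (delete vertices
-- while possible; c bounds the number of deletions).
shrinkToIrredundant : ∀ {n} c (S : Subset n) → ∣ S ∣ ≤ c → TotDom n ⟦ S ⟧ →
                      Σ (Subset n) λ T → TotDom n ⟦ T ⟧ × Irredundant T × (∀ i → ⟦ T ⟧ i ≡ true → ⟦ S ⟧ i ≡ true)
shrinkToIrredundant c S ∣S∣≤c td with deletable-or-irredundant S
... | inj₂ irr = S , td , irr , λ i e → e
shrinkToIrredundant zero S ∣S∣≤c td | inj₁ (u , _ , su , _) =
  contradiction (≤-trans (≤-reflexive (∣update-false∣ S su)) ∣S∣≤c) λ ()
shrinkToIrredundant (suc c) S ∣S∣≤c td | inj₁ (u , _ , su , td′)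
  with shrinkToIrredundant c (update S u false) (≤-pred (≤-trans (≤-reflexive (∣update-false∣ S su)) ∣S∣≤c)) td′
... | T , tdT , irr , T⊆S′ = T , tdT , irr , λ i e → S′⊆S i (T⊆S′ i e)
  where
  S′⊆S : ∀ i → ⟦ update S u false ⟧ i ≡ true → ⟦ S ⟧ i ≡ true
  S′⊆S i e with i ≟ u
  ... | yes refl = su
  ... | no i≢u = trans (sym (update-other S u false i i≢u)) e

-- Y (j - 1), where a stands for the value at position -1.
prevOr : Bool → (ℕ → Bool) → ℕ → Bool
prevOr a Y zero = a
prevOr a Y (suc j) = Y j

ClosedDom : Bool → (ℕ → Bool) → ℕ → Set
ClosedDom a Y m = ∀ j → j < m → (Y j ∨ prevOr a Y j ∨ Y (suc j)) ≡ true

VanishesFrom : (ℕ → Bool) → ℕ → Set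
VanishesFrom Y m = ∀ j → m ≤ j → Y j ≡ false

ClosedDom-tail : ∀ a Y m → ClosedDom a Y (suc m) → ClosedDom (Y 0) (λ i → Y (suc i)) m
ClosedDom-tail a Y m dom zero p = dom 1 (s≤s p)
ClosedDom-tail a Y m dom (suc j) p = dom (suc (suc j)) (s≤s p)

VanishesFrom-tail : ∀ Y m → VanishesFrom Y (suc m) → VanishesFrom (λ i → Y (suc i)) m
VanishesFrom-tail Y m van j p = van (suc j) (s≤s p)

-- Each vertex dominates at most three positions, so a dominating set of a path
-- with m vertices has at least m / 3 of them (a vertex at -1 helps by one).
closedDom-bound : ∀ m a Y → ClosedDom a Y m → VanishesFrom Y m → m ≤ 3 * count m Y + bit a
closedDom-bound zero a Y dom van = z≤n
closedDom-bound (suc m) a Y dom van with Y 0 in y₀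
... | true = grow (count m Y′) (closedDom-bound m true Y′ (subst (λ b → ClosedDom b Y′ m) y₀ (ClosedDom-tail a Y m dom))
                                              (VanishesFrom-tail Y m van))
  where
  Y′ : ℕ → Bool
  Y′ i = Y (suc i)
  grow : ∀ c → m ≤ 3 * c + 1 → suc m ≤ 3 * (1 + c) + bit a
  grow c h = subst (suc m ≤_) (sym (eq c (bit a))) (≤-trans (s≤s h) (m≤m+n _ _))
    where
    eq : ∀ c b → 3 * (1 + c) + b ≡ suc (3 * c + 1) + suc b
    eq = solve-∀
closedDom-bound (suc m) true Y dom van | false =
  grow (count m Y′) (closedDom-bound m false Y′ (subst (λ b → ClosedDom b Y′ m) y₀ (ClosedDom-tail true Y m dom))
                                   (VanishesFrom-tail Y m van))
  where
  Y′ : ℕ → Bool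
  Y′ i = Y (suc i)
  grow : ∀ c → m ≤ 3 * c + 0 → suc m ≤ 3 * (0 + c) + 1
  grow c h = subst (suc m ≤_) (sym (eq c)) (s≤s h)
    where
    eq : ∀ c → 3 * (0 + c) + 1 ≡ suc (3 * c + 0)
    eq = solve-∀
closedDom-bound (suc m) false Y dom van | false with secondVertex (dom 0 (s≤s z≤n))
  where
  -- position 0 is dominated neither by itself nor by position -1
  secondVertex : (Y 0 ∨ false ∨ Y 1) ≡ true → Y 1 ≡ true
  secondVertex h rewrite y₀ = h
closedDom-bound (suc zero) false Y dom van | false | y₁ = contradiction (trans (sym y₁) (van 1 ≤-refl)) true≢false
closedDom-bound (suc (suc m)) false Y dom van | false | y₁ =
  grow (count m Y″) y₁ (closedDom-bound m (Y 1) Y″ (ClosedDom-tail (Y 0) Y′ m (ClosedDom-tail false Y (suc m) dom))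
                                             (VanishesFrom-tail Y′ m (VanishesFrom-tail Y (suc m) van)))
  where
  Y′ : ℕ → Bool
  Y′ i = Y (suc i)
  Y″ : ℕ → Bool
  Y″ i = Y (suc (suc i))
  grow : ∀ c {b} → b ≡ true → m ≤ 3 * c + bit b → suc (suc m) ≤ 3 * (0 + (bit b + c)) + 0
  grow c refl h = subst (suc (suc m) ≤_) (sym (eq c)) (s≤s (s≤s h))
    where
    eq : ∀ c → 3 * (0 + (1 + c)) + 0 ≡ suc (suc (3 * c + 1))
    eq = solve-∀

-- The value of Γ_t(P_n): g n = 2⌊(n+1)/3⌋.
g : ℕ → ℕ
g 0 = 0
g 1 = 0
g 2 = 2
g (suc (suc (suc n))) = 2 + g n

frameTail : ℕ → (ℕ → Bool) → ℕ → Bool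
frameTail zero s zero = true
frameTail zero s (suc q) = false
frameTail (suc n) s zero = not (s 0)
frameTail (suc n) s (suc q) = frameTail n (λ i → s (suc i)) q

frame : ℕ → (ℕ → Bool) → ℕ → Bool
frame n s zero = true
frame n s (suc q) = frameTail n s q

frameTail-inside : ∀ n s {q} → q < n → frameTail n s q ≡ not (s q)
frameTail-inside (suc n) s {zero} _ = refl
frameTail-inside (suc n) s {suc q} (s≤s p) = frameTail-inside n (λ i → s (suc i)) p

frameTail-end : ∀ n s → frameTail n s n ≡ true
frameTail-end zero s = refl
frameTail-end (suc n) s = frameTail-end n (λ i → s (suc i))

frameTail-beyond : ∀ n s {q} → n < q → frameTail n s q ≡ false
frameTail-beyond zero s {suc q} _ = refl
frameTail-beyond (suc n) s {suc q} (s≤s p) = frameTail-beyond n (λ i → s (suc i)) p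

∣frame∣ : ∀ {n} (S : Subset n) → count (suc n) (frameTail n ⟦ S ⟧) + ∣ S ∣ ≡ suc n
∣frame∣ [] = refl
∣frame∣ (true ∷ S) = trans (+-suc _ _) (cong suc (∣frame∣ S))
∣frame∣ (false ∷ S) = cong suc (∣frame∣ S)

twoLeft : (ℕ → Bool) → ℕ → Bool
twoLeft w zero = false
twoLeft w (suc zero) = false
twoLeft w (suc (suc q)) = w q

DistTwoDom : ℕ → (ℕ → Bool) → Set
DistTwoDom n w = ∀ q → q ≤ 3 + n → q ≢ 2 + n → (w q ∨ twoLeft w q ∨ w (suc (suc q))) ≡ true

-- The frame of an irredundant TDS S dominates in the distance-two graph:
-- at a position q + 1 with q ∈ S, vertex q cannot be deleted, so by
-- deletion-safe one of q - 1, q + 1 loses its last other neighbour, i.e.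
-- q - 2 ∉ S (frame true at q - 1) or q + 2 ∉ S (frame true at q + 3).
module Frame {n} (S : Subset n) (td : TotDom n ⟦ S ⟧) (irr : Irredundant S) where
  s w : ℕ → Bool
  s = ⟦ S ⟧
  w = frame n s

  leftCovered : ∀ q → q < n → twoLeft w (suc q) ≡ false → LeftCovered s q
  leftCovered zero _ _ = inj₁ refl
  leftCovered (suc (suc r)) q<n e =
    inj₂ (r , refl , not≡false (trans (sym (frameTail-inside n s (<-trans (n<1+n r) (<-trans (n<1+n (suc r)) q<n)))) e))

  rightCovered : ∀ q → q < n → w (suc (suc (suc q))) ≡ false → RightCovered n s q
  rightCovered q q<n e with n ≤? suc q
  ... | yes n≤q+1 = inj₁ n≤q+1
  ... | no n≰q+1 with m≤n⇒m<n∨m≡n (≰⇒> n≰q+1)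
  ...   | inj₁ q+2<n = inj₂ (not≡false (trans (sym (frameTail-inside n s q+2<n)) e))
  ...   | inj₂ q+2≡n = contradiction (trans (sym (frameTail-end n s)) (trans (cong (frameTail n s) (sym q+2≡n)) e)) true≢false

  frameDom : ∀ q → q ≤ suc n → (w q ∨ twoLeft w q ∨ w (suc (suc q))) ≡ true
  frameDom zero _ = refl
  frameDom (suc q) q<n+1 with m≤n⇒m<n∨m≡n (≤-pred q<n+1)
  ... | inj₂ refl = ∨-introˡ _ (frameTail-end n s)
  ... | inj₁ q<n with s q in sq
  ...   | false = ∨-introˡ _ (trans (frameTail-inside n s q<n) (cong not sq))
  ...   | true = ∨-introʳ (w (suc q)) (orElse λ left right →
                   irr q sq (deletion-safe n s ⟦ update S q false ⟧ q td (update-other S q false)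
                                           (update-same S false q<n) (leftCovered q q<n left) (rightCovered q q<n right)))
    where
    orElse : ∀ {a b} → (a ≡ false → b ≡ false → ⊥) → a ∨ b ≡ true
    orElse {true} h = refl
    orElse {false} {true} h = refl
    orElse {false} {false} h = ⊥-elim (h refl refl)

  distTwoDom : DistTwoDom n w
  distTwoDom q q≤n+3 q≢n+2 with m≤n⇒m<n∨m≡n q≤n+3
  ... | inj₂ refl = ∨-introʳ (w q) (∨-introˡ _ (frameTail-end n s))
  ... | inj₁ q<n+3 with m≤n⇒m<n∨m≡n (≤-pred q<n+3)
  ...   | inj₂ q≡n+2 = contradiction q≡n+2 q≢n+2
  ...   | inj₁ q<n+2 = frameDom q (≤-pred q<n+2)

  vanishes : ∀ q → 2 + n ≤ q → w q ≡ false
  vanishes (suc q) (s≤s p) = frameTail-beyond n s p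

double : ℕ → ℕ
double zero = zero
double (suc n) = suc (suc (double n))

double-mono : ∀ {a b} → a ≤ b → double a ≤ double b
double-mono z≤n = z≤n
double-mono (s≤s p) = s≤s (s≤s (double-mono p))

double≢odd : ∀ a b → double a ≢ suc (double b)
double≢odd zero b ()
double≢odd (suc a) zero e = 1+n≢0 (suc-injective e)
double≢odd (suc a) (suc b) e = double≢odd a b (suc-injective (suc-injective e))

parity : ∀ n → Σ ℕ λ h → n ≡ double h ⊎ n ≡ suc (double h)
parity zero = 0 , inj₁ refl
parity (suc zero) = 0 , inj₂ refl
parity (suc (suc n)) with parity n
... | h , inj₁ e = suc h , inj₁ (cong (λ x → suc (suc x)) e)
... | h , inj₂ e = suc h , inj₂ (cong (λ x → suc (suc x)) e)

-- The distance-two graph splits into the path of even positions and the path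
-- of odd positions; we count w on each.  For the even path a virtual false
-- position is put in front, which position 0 (always in the frame) dominates.
evens odds evensShifted : (ℕ → Bool) → ℕ → Bool
evens w j = w (double j)
odds w j = w (suc (double j))
evensShifted w zero = false
evensShifted w (suc j) = w (double j)

count-double : ∀ m w → count (double m) w ≡ count m (evens w) + count m (odds w)
count-double zero w = refl
count-double (suc m) w =
  trans (cong (λ z → bit (w 0) + (bit (w 1) + z)) (count-double m (λ i → w (suc (suc i)))))
        (shuffle (bit (w 0)) (bit (w 1)) _ _)
  where
  shuffle : ∀ a b x y → a + (b + (x + y)) ≡ (a + x) + (b + y)
  shuffle = solve-∀

count-double+1 : ∀ m w → count (suc (double m)) w ≡ count (suc m) (evens w) + count m (odds w)
count-double+1 m w = trans (cong (bit (w 0) +_) (count-double m (λ i → w (suc i)))) (shuffle (bit (w 0)) _ _)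
  where
  shuffle : ∀ a x y → a + (x + y) ≡ (a + y) + x
  shuffle = solve-∀

count-last-false : ∀ m Y → Y m ≡ false → count (suc m) Y ≡ count m Y
count-last-false zero Y e rewrite e = refl
count-last-false (suc m) Y e = cong (bit (Y 0) +_) (count-last-false m (λ i → Y (suc i)) e)

evensShifted-dom : ∀ n w → DistTwoDom n w → w 0 ≡ true → ∀ L →
                   (∀ j → suc j < L → double j ≤ 3 + n × double j ≢ 2 + n) → ClosedDom false (evensShifted w) L
evensShifted-dom n w dom w0 L inRange zero p = w0
evensShifted-dom n w dom w0 L inRange (suc zero) p = dom 0 (proj₁ (inRange 0 p)) (proj₂ (inRange 0 p))
evensShifted-dom n w dom w0 L inRange (suc (suc j)) p = dom _ (proj₁ (inRange (suc j) p)) (proj₂ (inRange (suc j) p))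

odds-dom : ∀ n w → DistTwoDom n w → ∀ L →
           (∀ j → j < L → suc (double j) ≤ 3 + n × suc (double j) ≢ 2 + n) → ClosedDom false (odds w) L
odds-dom n w dom L inRange zero p = dom 1 (proj₁ (inRange 0 p)) (proj₂ (inRange 0 p))
odds-dom n w dom L inRange (suc j) p = dom _ (proj₁ (inRange (suc j) p)) (proj₂ (inRange (suc j) p))

evensShifted-vanishes : ∀ n w → (∀ q → 2 + n ≤ q → w q ≡ false) → ∀ L →
                        (∀ j → L ≤ suc j → 2 + n ≤ double j) → VanishesFrom (evensShifted w) L
evensShifted-vanishes n w van L beyond zero p = refl
evensShifted-vanishes n w van L beyond (suc j) p = van _ (beyond j p)

odds-vanishes : ∀ n w → (∀ q → 2 + n ≤ q → w q ≡ false) → ∀ L →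
                (∀ j → L ≤ j → 2 + n ≤ suc (double j)) → VanishesFrom (odds w) L
odds-vanishes n w van L beyond j p = van _ (beyond j p)

ceil3 : ∀ c C {m} → 3 * c < m → m ≤ 3 * C → c < C
ceil3 c C lt le = *-cancelˡ-< 3 c C (<-≤-trans lt le)

peel : ∀ x C → 3 + x ≤ 3 * C → Σ ℕ λ C′ → C ≡ suc C′ × x ≤ 3 * C′
peel x (suc C′) le = C′ , refl , ≤-pred (≤-pred (≤-pred (subst (3 + x ≤_) (*-suc 3 C′) le)))

-- The inductive step shared by both parities: three more positions on each
-- path give one more frame element there and raise g by four.
arith-step : ∀ {x a b G} → x ≤ a + b + G → 6 + x ≤ suc a + suc b + (2 + (2 + G))
arith-step {x} {a} {b} {G} le = subst (6 + x ≤_) (sym (eq a b G)) (+-monoʳ-≤ 6 le)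
  where
  eq : ∀ a b G → suc a + suc b + (2 + (2 + G)) ≡ 6 + (a + b + G)
  eq = solve-∀

arith-even : ∀ h C₀ C₁ → 2 + h ≤ 3 * C₀ → 2 + h ≤ 3 * C₁ → 2 + double h ≤ C₀ + C₁ + g (double h)
arith-even 0 C₀ C₁ p q = +-monoˡ-≤ 0 (+-mono-≤ (ceil3 0 C₀ (s≤s z≤n) p) (ceil3 0 C₁ (s≤s z≤n) q))
arith-even 1 C₀ C₁ p q = +-monoˡ-≤ 2 (+-mono-≤ (ceil3 0 C₀ (s≤s z≤n) p) (ceil3 0 C₁ (s≤s z≤n) q))
arith-even 2 C₀ C₁ p q = +-monoˡ-≤ 2 (+-mono-≤ (ceil3 1 C₀ ≤-refl p) (ceil3 1 C₁ ≤-refl q))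
arith-even (suc (suc (suc h))) C₀ C₁ p q with peel (2 + h) C₀ p | peel (2 + h) C₁ q
... | a , refl , p′ | b , refl , q′ = arith-step (arith-even h a b p′ q′)

arith-odd : ∀ h C₀ C₁ → 4 + h ≤ 3 * C₀ → 1 + h ≤ 3 * C₁ → 3 + double h ≤ C₀ + C₁ + g (suc (double h))
arith-odd 0 C₀ C₁ p q = +-monoˡ-≤ 0 (+-mono-≤ (ceil3 1 C₀ ≤-refl p) (ceil3 0 C₁ ≤-refl q))
arith-odd 1 C₀ C₁ p q = +-monoˡ-≤ 2 (+-mono-≤ (ceil3 1 C₀ (n≤1+n 4) p) (ceil3 0 C₁ (s≤s z≤n) q))
arith-odd 2 C₀ C₁ p q = +-monoˡ-≤ 4 (+-mono-≤ (ceil3 1 C₀ (m≤m+n 4 2) p) (ceil3 0 C₁ (s≤s z≤n) q))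
arith-odd (suc (suc (suc h))) C₀ C₁ p q with peel (4 + h) C₀ p | peel (1 + h) C₁ q
... | a , refl , p′ | b , refl , q′ = arith-step (arith-odd h a b p′ q′)

-- The bound ∣ S ∣ ≤ g n for irredundant TDSs, for n = 2h: the even and the
-- odd path both have h + 1 positions (plus the virtual one in front of the
-- even path), and the frame has n + 2 - ∣ S ∣ elements.
irredundant-bound-even : ∀ h (S : Subset (double h)) → TotDom (double h) ⟦ S ⟧ → Irredundant S → ∣ S ∣ ≤ g (double h)
irredundant-bound-even h S td irr = +-cancelˡ-≤ (C₀ + C₁) ∣ S ∣ (g (double h)) (begin
    C₀ + C₁ + ∣ S ∣          ≡⟨ sizes ⟩
    2 + double h             ≤⟨ arith-even h C₀ C₁ evenBound oddBound ⟩
    C₀ + C₁ + g (double h)   ∎)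
  where
  open Frame S td irr
  open ≤-Reasoning
  C₀ C₁ : ℕ
  C₀ = count (suc h) (evens w)
  C₁ = count (suc h) (odds w)
  evenBound : 2 + h ≤ 3 * C₀
  evenBound = subst (2 + h ≤_) (+-identityʳ _)
    -- the even positions below 2h + 2 lie in range and differ from n + 2
    (closedDom-bound (2 + h) false (evensShifted w)
      (evensShifted-dom (double h) w distTwoDom refl (2 + h)
        (λ j p → ≤-trans (double-mono (≤-pred (≤-pred p))) (m≤n+m _ 3) ,
                 <⇒≢ (≤-trans (s≤s (double-mono (≤-pred (≤-pred p)))) (n≤1+n _))))
      (evensShifted-vanishes (double h) w vanishes (2 + h) (λ j p → double-mono (≤-pred p))))
  oddBound : 2 + h ≤ 3 * C₁
  oddBound = subst (2 + h ≤_) (trans (+-identityʳ _) (cong (3 *_) (count-last-false (suc h) (odds w) (vanishes _ (n≤1+n _)))))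
    (closedDom-bound (2 + h) false (odds w)
      (odds-dom (double h) w distTwoDom (2 + h)
        (λ j p → s≤s (double-mono (≤-pred p)) , λ e → double≢odd (suc h) j (sym e)))
      (odds-vanishes (double h) w vanishes (2 + h)
        (λ j p → ≤-trans (m≤n+m (2 + double h) 2) (m≤n⇒m≤1+n (double-mono {2 + h} {j} p)))))
  sizes : C₀ + C₁ + ∣ S ∣ ≡ 2 + double h
  sizes = trans (cong (_+ ∣ S ∣) (sym (count-double (suc h) w))) (cong suc (∣frame∣ S))

-- … and for n = 2h + 1, where the even path has h + 2 positions and the odd one h + 1.
irredundant-bound-odd : ∀ h (S : Subset (suc (double h))) → TotDom (suc (double h)) ⟦ S ⟧ → Irredundant S →
                        ∣ S ∣ ≤ g (suc (double h))
irredundant-bound-odd h S td irr = +-cancelˡ-≤ (C₀ + C₁) ∣ S ∣ (g (suc (double h))) (begin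
    C₀ + C₁ + ∣ S ∣                ≡⟨ sizes ⟩
    3 + double h                   ≤⟨ arith-odd h C₀ C₁ evenBound oddBound ⟩
    C₀ + C₁ + g (suc (double h))   ∎)
  where
  open Frame S td irr
  open ≤-Reasoning
  C₀ C₁ : ℕ
  C₀ = count (suc (suc h)) (evens w)
  C₁ = count (suc h) (odds w)
  evenBound : 4 + h ≤ 3 * C₀
  evenBound = subst (4 + h ≤_) (trans (+-identityʳ _) (cong (3 *_) (count-last-false (2 + h) (evens w) (vanishes _ (n≤1+n _)))))
    -- the even positions up to 2h + 4 lie in range, and are never n + 2 = 2h + 3
    (closedDom-bound (4 + h) false (evensShifted w)
      (evensShifted-dom (suc (double h)) w distTwoDom refl (4 + h)
        (λ j p → double-mono {j} {2 + h} (≤-pred (≤-pred p)) , λ e → double≢odd j (suc h) e))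
      (evensShifted-vanishes (suc (double h)) w vanishes (4 + h)
        (λ j p → ≤-trans (m≤n+m (3 + double h) 3) (double-mono {3 + h} {j} (≤-pred p)))))
  oddBound : 1 + h ≤ 3 * C₁
  oddBound = subst (1 + h ≤_) (+-identityʳ _)
    (closedDom-bound (1 + h) false (odds w)
      (odds-dom (suc (double h)) w distTwoDom (1 + h)
        (λ j p → ≤-trans (s≤s (double-mono (≤-pred p))) (m≤n+m _ 3) ,
                 <⇒≢ (s≤s (≤-trans (s≤s (double-mono (≤-pred p))) (n≤1+n _)))))
      (odds-vanishes (suc (double h)) w vanishes (1 + h) (λ j p → s≤s (double-mono p))))
  sizes : C₀ + C₁ + ∣ S ∣ ≡ 3 + double h
  sizes = trans (cong (_+ ∣ S ∣) (sym (count-double+1 (suc h) w))) (cong suc (∣frame∣ S))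

irredundant-bound : ∀ {n} (S : Subset n) → TotDom n ⟦ S ⟧ → Irredundant S → ∣ S ∣ ≤ g n
irredundant-bound {n} S with parity n
... | h , inj₁ refl = irredundant-bound-even h S
... | h , inj₂ refl = irredundant-bound-odd h S

mod3 : ℕ → ℕ
mod3 0 = 0
mod3 1 = 1
mod3 2 = 2
mod3 (suc (suc (suc n))) = mod3 n

data Residue : ℕ → Set where
  r₀ : ∀ q → Residue (q * 3)
  r₁ : ∀ q → Residue (suc (q * 3))
  r₂ : ∀ q → Residue (suc (suc (q * 3)))

residue : ∀ v → Residue v
residue 0 = r₀ 0
residue 1 = r₁ 0
residue 2 = r₂ 0
residue (suc (suc (suc v))) with residue v
... | r₀ q = r₀ (suc q)
... | r₁ q = r₁ (suc q)
... | r₂ q = r₂ (suc q)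

mod3-r₁ : ∀ q → mod3 (suc (q * 3)) ≡ 1
mod3-r₁ zero = refl
mod3-r₁ (suc q) = mod3-r₁ q

mod3-r₂ : ∀ q → mod3 (suc (suc (q * 3))) ≡ 2
mod3-r₂ zero = refl
mod3-r₂ (suc q) = mod3-r₂ q

block : ℕ → Bool
block 0 = true
block 1 = true
block 2 = false
block (suc (suc (suc v))) = block v

block-r₀ : ∀ q → block (q * 3) ≡ true
block-r₀ zero = refl
block-r₀ (suc q) = block-r₀ q

block-r₁ : ∀ q → block (suc (q * 3)) ≡ true
block-r₁ zero = refl
block-r₁ (suc q) = block-r₁ q

block-r₂ : ∀ q → block (suc (suc (q * 3))) ≡ false
block-r₂ zero = refl
block-r₂ (suc q) = block-r₂ q

block-triple : ∀ v → bit (block v) + (bit (block (suc v)) + bit (block (suc (suc v)))) ≡ 2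
block-triple 0 = refl
block-triple 1 = refl
block-triple 2 = refl
block-triple (suc (suc (suc v))) = block-triple v

-- The extremal TDS of P_n is the pattern 110110… restricted to the path,
-- except when n ≡ 1 (mod 3), where the pattern shifted to 011011… is used.
offset : ℕ → ℕ
offset 0 = 0
offset 1 = 2
offset 2 = 0
offset (suc (suc (suc n))) = offset n

offset-cases : ∀ n → (offset n ≡ 0 × mod3 n ≢ 1) ⊎ (offset n ≡ 2 × mod3 n ≡ 1)
offset-cases 0 = inj₁ (refl , λ ())
offset-cases 1 = inj₂ (refl , refl)
offset-cases 2 = inj₁ (refl , λ ())
offset-cases (suc (suc (suc n))) = offset-cases n

extremal : (n : ℕ) → Subset n
extremal n = fromFun n (λ v → block (offset n + v))

deletion-breaks-right : ∀ {n} (S : Subset n) p → suc p < n → ⟦ S ⟧ (suc (suc p)) ≡ false →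
                        ¬ TotDom n ⟦ update S p false ⟧
deletion-breaks-right S p p+1<n absent =
  undominated (suc p) p+1<n (trans (update-other S p false _ (λ e → r≢2+r p (sym e))) absent)
              (update-same S false (<-trans (n<1+n p) p+1<n))

deletion-breaks-left : ∀ {n} (S : Subset n) r → suc r < n → leftOf ⟦ S ⟧ r ≡ false →
                       ¬ TotDom n ⟦ update S (suc r) false ⟧
deletion-breaks-left S r r+1<n absent = undominated r (<-trans (n<1+n r) r+1<n) (update-same S false r+1<n) (left r absent)
  where
  left : ∀ r → leftOf ⟦ S ⟧ r ≡ false → leftOf ⟦ update S (suc r) false ⟧ r ≡ false
  left zero _ = refl
  left (suc u) e = trans (update-other S (suc (suc u)) false u (r≢2+r u)) e

-- For n ≢ 1 (mod 3) the pattern 110110… totally dominates P_n: a vertex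
-- 3q is dominated by 3q + 1, which exists, and the others from the left.
block-TotDom : ∀ n → mod3 n ≢ 1 → TotDom n ⟦ fromFun n block ⟧
block-TotDom n n≢1 v v<n with residue v
... | r₀ q = ∨-introˡ _ (trans (⟦fromFun⟧ n block (≤∧≢⇒< v<n (λ e → n≢1 (trans (sym (cong mod3 e)) (mod3-r₁ q)))))
                               (block-r₁ q))
... | r₁ q = ∨-introʳ _ (trans (⟦fromFun⟧ n block (<-trans (n<1+n _) v<n)) (block-r₀ q))
... | r₂ q = ∨-introʳ _ (trans (⟦fromFun⟧ n block (<-trans (n<1+n _) v<n)) (block-r₁ q))

-- Each vertex of the pattern is the only neighbour of one of its neighbours.
block-irredundant : ∀ n → mod3 n ≢ 1 → Irredundant (fromFun n block)
block-irredundant n n≢1 p e with residue p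
... | r₀ q = deletion-breaks-right S (q * 3)
               (≤∧≢⇒< (⟦⟧-true⇒< S _ e) (λ eq → n≢1 (trans (sym (cong mod3 eq)) (mod3-r₁ q))))
               (⟦fromFun⟧-false n block _ (block-r₂ q))
  where
  S : Subset n
  S = fromFun n block
... | r₁ q = deletion-breaks-left S (q * 3) (⟦⟧-true⇒< S _ e) (noLeft q)
  where
  S : Subset n
  S = fromFun n block
  noLeft : ∀ q → leftOf ⟦ S ⟧ (q * 3) ≡ false
  noLeft zero = refl
  noLeft (suc q) = ⟦fromFun⟧-false n block _ (block-r₂ q)
... | r₂ q = contradiction (trans (sym e) (⟦fromFun⟧-false n block _ (block-r₂ q))) true≢false

shifted : ℕ → Bool
shifted v = block (2 + v)

shifted-TotDom : ∀ n → 2 ≤ n → mod3 n ≢ 2 → TotDom n ⟦ fromFun n shifted ⟧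
shifted-TotDom n 2≤n n≢2 v v<n with residue v
... | r₀ zero = ∨-introˡ _ (⟦fromFun⟧ n shifted 2≤n)
... | r₀ (suc q) = ∨-introʳ _ (trans (⟦fromFun⟧ n shifted (<-trans (n<1+n _) v<n)) (block-r₁ q))
... | r₁ q = ∨-introˡ _ (trans (⟦fromFun⟧ n shifted (≤∧≢⇒< v<n (λ e → n≢2 (trans (sym (cong mod3 e)) (mod3-r₂ q)))))
                               (block-r₁ q))
... | r₂ q = ∨-introʳ _ (trans (⟦fromFun⟧ n shifted (<-trans (n<1+n _) v<n)) (block-r₀ q))

shifted-irredundant : ∀ n → mod3 n ≢ 2 → Irredundant (fromFun n shifted)
shifted-irredundant n n≢2 p e with residue p
... | r₀ q = contradiction (trans (sym e) (⟦fromFun⟧-false n shifted _ (block-r₂ q))) true≢false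
... | r₁ q = deletion-breaks-right S (suc (q * 3))
               (≤∧≢⇒< (⟦⟧-true⇒< S _ e) (λ eq → n≢2 (trans (sym (cong mod3 eq)) (mod3-r₂ q))))
               (⟦fromFun⟧-false n shifted _ (block-r₂ q))
  where
  S : Subset n
  S = fromFun n shifted
... | r₂ q = deletion-breaks-left S (suc (q * 3)) (⟦⟧-true⇒< S _ e) (⟦fromFun⟧-false n shifted _ (block-r₂ q))
  where
  S : Subset n
  S = fromFun n shifted

extremal-as : ∀ n {o} → offset n ≡ o → extremal n ≡ fromFun n (λ v → block (o + v))
extremal-as n refl = refl

1≢2 : ∀ {m} → m ≡ 1 → m ≢ 2
1≢2 refl ()

extremal-TotDom : ∀ n → 2 ≤ n → TotDom n ⟦ extremal n ⟧
extremal-TotDom n 2≤n with offset-cases n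
... | inj₁ (o≡0 , n≢1) = subst (λ S → TotDom n ⟦ S ⟧) (sym (extremal-as n o≡0)) (block-TotDom n n≢1)
... | inj₂ (o≡2 , n≡1) = subst (λ S → TotDom n ⟦ S ⟧) (sym (extremal-as n o≡2)) (shifted-TotDom n 2≤n (1≢2 n≡1))

extremal-irredundant : ∀ n → Irredundant (extremal n)
extremal-irredundant n with offset-cases n
... | inj₁ (o≡0 , n≢1) = subst Irredundant (sym (extremal-as n o≡0)) (block-irredundant n n≢1)
... | inj₂ (o≡2 , n≡1) = subst Irredundant (sym (extremal-as n o≡2)) (shifted-irredundant n (1≢2 n≡1))

count-snoc : ∀ n f → count (suc n) f ≡ count n f + bit (f n)
count-snoc zero f = +-comm (bit (f 0)) 0
count-snoc (suc n) f = trans (cong (bit (f 0) +_) (count-snoc n (λ i → f (suc i)))) (sym (+-assoc (bit (f 0)) _ _))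

count-three-more : ∀ n f → count (3 + n) f ≡ count n f + (bit (f n) + (bit (f (1 + n)) + bit (f (2 + n))))
count-three-more n f = begin
  count (3 + n) f                                          ≡⟨ count-snoc (2 + n) f ⟩
  count (2 + n) f + c                                      ≡⟨ cong (_+ c) (count-snoc (1 + n) f) ⟩
  count (1 + n) f + b + c                                  ≡⟨ cong (λ z → z + b + c) (count-snoc n f) ⟩
  count n f + a + b + c                                    ≡⟨ reassoc (count n f) a b c ⟩
  count n f + (a + (b + c))                                ∎
  where
  open ≡-Reasoning
  a b c : ℕ
  a = bit (f n)
  b = bit (f (1 + n))
  c = bit (f (2 + n))
  reassoc : ∀ w x y z → w + x + y + z ≡ w + (x + (y + z))
  reassoc = solve-∀

-- The extremal set has g n vertices: every three positions contribute two.
∣extremal∣ : ∀ n → ∣ extremal n ∣ ≡ g n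
∣extremal∣ n = trans (∣fromFun∣ n _) (counted n)
  where
  triple : ∀ o n → bit (block (o + n)) + (bit (block (o + suc n)) + bit (block (o + suc (suc n)))) ≡ 2
  triple o n rewrite +-suc o (suc n) | +-suc o n = block-triple (o + n)
  counted : ∀ n → count n (λ v → block (offset n + v)) ≡ g n
  counted 0 = refl
  counted 1 = refl
  counted 2 = refl
  counted (suc (suc (suc n))) =
    trans (count-three-more n _) (trans (cong₂ _+_ (counted n) (triple (offset n) n)) (+-comm (g n) 2))

extremal-minimal : ∀ n → 2 ≤ n → IsMinimalTDS (P n) (extremal n)
extremal-minimal n 2≤n = irredundant⇒minimal (extremal n) (extremal-TotDom n 2≤n) (extremal-irredundant n)

upperTotalDom : ∀ n → 2 ≤ n → IsUpperTotalDom (P n) (g n)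
upperTotalDom n 2≤n =
  (extremal n , extremal-minimal n 2≤n , ∣extremal∣ n) ,
  λ S min → irredundant-bound S (isTDS⇒TotDom S (proj₁ min)) (minimal⇒irredundant S min)

-- The canonical TDS S* that every small TDS is moved to.  Its gaps are chosen
-- greedily from the left among the admissible positions (not 1, not n - 2,
-- inside the path), skipping a position two to the right of a gap.
Admissible : ℕ → ℕ → Set
Admissible n v = v ≢ 1 × 2 + v ≢ n × v < n

admissible? : ∀ n v → Dec (Admissible n v)
admissible? n v = ¬? (v ≟ 1) ×-dec ¬? (2 + v ≟ n) ×-dec (v <? n)

gap : ℕ → ℕ → Bool
gap n zero = does (admissible? n 0)
gap n (suc zero) = false
gap n (suc (suc v)) = does (admissible? n (2 + v)) ∧ not (gap n v)

canonical : (n : ℕ) → Subset n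
canonical n = fromFun n (λ v → not (gap n v))

gap-true : ∀ {n} u → gap n u ≡ true → Admissible n u × (∀ r → u ≡ 2 + r → gap n r ≡ false)
gap-true {n} zero e = does-true (admissible? n 0) e , λ r ()
gap-true {n} (suc (suc v)) e with ∧-elim _ _ e
... | admissible , notGap = does-true (admissible? n (2 + v)) admissible , λ { r refl → not≡true notGap }

gap-false : ∀ {n} u → gap n u ≡ false → u ≡ 1 ⊎ 2 + u ≡ n ⊎ n ≤ u ⊎ Σ ℕ λ r → u ≡ 2 + r × gap n r ≡ true
gap-false {n} zero e = notAdmissible (does-false (admissible? n 0) e)
  where
  notAdmissible : ¬ Admissible n 0 → 0 ≡ 1 ⊎ 2 ≡ n ⊎ n ≤ 0 ⊎ Σ ℕ λ r → 0 ≡ 2 + r × gap n r ≡ true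
  notAdmissible ¬adm with 2 ≟ n | 0 <? n
  ... | yes 2≡n | _ = inj₂ (inj₁ 2≡n)
  ... | no 2≢n | yes 0<n = contradiction ((λ ()) , 2≢n , 0<n) ¬adm
  ... | no _ | no 0≮n = inj₂ (inj₂ (inj₁ (≮⇒≥ 0≮n)))
gap-false (suc zero) e = inj₁ refl
gap-false {n} (suc (suc v)) e with ∧-false _ _ e
... | inj₂ gapLeft = inj₂ (inj₂ (inj₂ (v , refl , not≡false gapLeft)))
... | inj₁ notAdm with 4 + v ≟ n | 2 + v <? n
...   | yes 4+v≡n | _ = inj₂ (inj₁ 4+v≡n)
...   | no 4+v≢n | yes v+2<n = contradiction ((λ ()) , 4+v≢n , v+2<n) (does-false (admissible? n (2 + v)) notAdm)
...   | no _ | no v+2≮n = inj₂ (inj₂ (inj₁ (≮⇒≥ v+2≮n)))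

Agree : ∀ {n} → Subset n → ℕ → Set
Agree {n} S j = ∀ i → i < j → ⟦ S ⟧ i ≡ not (gap n i)

-- A position u that is not a gap is forced: a TDS agreeing with S* below u
-- must contain u, since some vertex (0, n - 1 or u - 1) has u as its only
-- possible neighbour.
forced : ∀ {n} (S : Subset n) (s′ : ℕ → Bool) u → Agree S u → gap n u ≡ false → u < n →
         (∀ i → i ≢ u → s′ i ≡ ⟦ S ⟧ i) → s′ u ≡ false → ¬ TotDom n s′
forced {n} S s′ u agree notGap u<n same s′u with gap-false u notGap
... | inj₁ refl = undominated 0 (<-trans (s≤s z≤n) u<n) s′u refl
... | inj₂ (inj₁ u+2≡n) =
  undominated (suc u) (subst (suc u <_) u+2≡n ≤-refl)
    (trans (same _ (λ e → r≢2+r u (sym e))) (trans (cong ⟦ S ⟧ u+2≡n) (⟦⟧-beyond S ≤-refl))) s′u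
... | inj₂ (inj₂ (inj₁ n≤u)) = contradiction n≤u (<⇒≱ u<n)
... | inj₂ (inj₂ (inj₂ (r , refl , gapR))) =
  undominated (suc r) (<-trans (n<1+n _) u<n) s′u
    (trans (same r (r≢2+r r)) (trans (agree r (<-trans (n<1+n r) (n<1+n (suc r)))) (cong not gapR)))

gap-leftCovered : ∀ {n} (S : Subset n) j → gap n j ≡ true → Agree S j → LeftCovered ⟦ S ⟧ j
gap-leftCovered S zero _ _ = inj₁ refl
gap-leftCovered S (suc (suc r)) gj agree =
  inj₂ (r , refl , trans (agree r (<-trans (n<1+n r) (n<1+n (suc r)))) (cong not (proj₂ (gap-true _ gj) r refl)))

agree-extend : ∀ {n} (S : Subset n) j → Agree S j → ⟦ S ⟧ j ≡ not (gap n j) → Agree S (suc j)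
agree-extend S j agree eq i i<j+1 with m≤n⇒m<n∨m≡n (≤-pred i<j+1)
... | inj₁ i<j = agree i i<j
... | inj₂ refl = eq

agree-update : ∀ {n} (S : Subset n) p b j → j ≤ p → Agree S j → Agree (update S p b) j
agree-update S p b j j≤p agree i i<j = trans (update-other S p b i (<⇒≢ (<-≤-trans i<j j≤p))) (agree i i<j)

update-oneStep : ∀ {n} (S : Subset n) {p} b (p<n : p < n) → ⟦ S ⟧ p ≢ b → OneStep S (update S p b)
update-oneStep {n} S {p} b p<n changed = fromℕ< p<n , differs , agrees
  where
  at : ∀ (T : Subset n) → lookup T (fromℕ< p<n) ≡ ⟦ T ⟧ p
  at T = trans (lookup≡⟦⟧ T _) (cong ⟦ T ⟧ (toℕ-fromℕ< p<n))
  differs : lookup S (fromℕ< p<n) ≢ lookup (update S p b) (fromℕ< p<n)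
  differs e = changed (trans (sym (at S)) (trans e (trans (at (update S p b)) (update-same S b p<n))))
  agrees : ∀ w → w ≢ fromℕ< p<n → lookup S w ≡ lookup (update S p b) w
  agrees w w≢p = trans (lookup≡⟦⟧ S w) (trans (sym (update-other S p b (toℕ w) w≢p′)) (sym (lookup≡⟦⟧ (update S p b) w)))
    where
    w≢p′ : toℕ w ≢ p
    w≢p′ e = w≢p (toℕ-injective (trans e (sym (toℕ-fromℕ< p<n))))

DEdge-sym : ∀ {G k S T} → DEdge G k S T → DEdge G k T S
DEdge-sym (dS , dT , v , differs , agrees) = dT , dS , v , (λ e → differs (sym e)) , (λ w w≢v → sym (agrees w w≢v))

-- Connectivity of D_k(P_n) for k > g n, by moving every vertex to S*.
module Reconfiguration (n k : ℕ) (g<k : g n < k) where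

  Small : Subset n → Set
  Small S = TotDom n ⟦ S ⟧ × ∣ S ∣ ≤ k

  toVertex : ∀ S → Small S → IsDVertex (P n) k S
  toVertex S (td , ∣S∣≤k) = TotDom⇒isTDS S td , ∣S∣≤k

  fromVertex : ∀ S → IsDVertex (P n) k S → Small S
  fromVertex S (tds , ∣S∣≤k) = isTDS⇒TotDom S tds , ∣S∣≤k

  Path : Subset n → Subset n → Set
  Path = Star (DEdge (P n) k)

  step : ∀ S {p} b → p < n → ⟦ S ⟧ p ≢ b → Small S → Small (update S p b) → Path S (update S p b)
  step S b p<n changed small small′ = (toVertex S small , toVertex _ small′ , update-oneStep S b p<n changed) ◅ ε

  data Progress (j : ℕ) (S : Subset n) : Set where
    advance : (S′ : Subset n) → Path S S′ → Small S′ → Agree S′ (suc j) → Progress j S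
    shrink : (S′ : Subset n) → Path S S′ → Small S′ → Agree S′ j → ∣ S′ ∣ < ∣ S ∣ → Progress j S

  deleteStep : ∀ j S → j < n → Small S → Agree S j → ⟦ S ⟧ j ≡ true → gap n j ≡ true →
               TotDom n ⟦ update S j false ⟧ → Progress j S
  deleteStep j S j<n small agree sj gj td′ =
    advance S′ (step S false j<n (λ e → true≢false (trans (sym sj) e)) small small′) small′
            (agree-extend S′ j (agree-update S j false j ≤-refl agree) (trans (update-same S false j<n) (cong not (sym gj))))
    where
    S′ : Subset n
    S′ = update S j false
    small′ : Small S′
    small′ = td′ , ≤-trans (n≤1+n _) (≤-trans (≤-reflexive (∣update-false∣ S sj)) (proj₂ small))

  -- If deleting j alone fails, the vertex j + 1 depends on j (j + 2 ∉ S);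
  -- then add j + 2 and delete j: the size is unchanged.
  swapStep : ∀ j S → j < n → Small S → Agree S j → ⟦ S ⟧ j ≡ true → gap n j ≡ true →
             ¬ TotDom n ⟦ update S j false ⟧ → ∣ S ∣ < k → Progress j S
  swapStep j S j<n small agree sj gj ¬td′ ∣S∣<k =
    advance S₂ (step S true j+2<n (λ e → true≢false (trans (sym e) sj+2)) small small₁
                 ◅◅ step S₁ false j<n (λ e → true≢false (trans (sym s₁j) e)) small₁ small₂)
            small₂ agree₂
    where
    left : LeftCovered ⟦ S ⟧ j
    left = gap-leftCovered S j gj agree
    ¬right : ¬ RightCovered n ⟦ S ⟧ j
    ¬right right = ¬td′ (deletion-safe n ⟦ S ⟧ _ j (proj₁ small) (update-other S j false) (update-same S false j<n) left right)
    j+2<n : suc (suc j) < n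
    j+2<n = ≤∧≢⇒< (≰⇒> (λ n≤j+1 → ¬right (inj₁ n≤j+1))) (proj₁ (proj₂ (proj₁ (gap-true j gj))))
    sj+2 : ⟦ S ⟧ (suc (suc j)) ≡ false
    sj+2 = ≢true (λ e → ¬right (inj₂ e))
    S₁ S₂ : Subset n
    S₁ = update S (suc (suc j)) true
    S₂ = update S₁ j false
    s₁j : ⟦ S₁ ⟧ j ≡ true
    s₁j = trans (update-other S _ true j (r≢2+r j)) sj
    td₁ : TotDom n ⟦ S₁ ⟧
    td₁ = TotDom-mono (proj₁ small) added
      where
      added : ∀ i → ⟦ S ⟧ i ≡ true → ⟦ S₁ ⟧ i ≡ true
      added i e with i ≟ suc (suc j)
      ... | yes refl = update-same S true j+2<n
      ... | no i≢j+2 = trans (update-other S _ true i i≢j+2) e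
    small₁ : Small S₁
    small₁ = td₁ , subst (_≤ k) (sym (∣update-true∣ S sj+2 j+2<n)) ∣S∣<k
    left₁ : LeftCovered ⟦ S₁ ⟧ j
    left₁ with left
    ... | inj₁ j≡0 = inj₁ j≡0
    ... | inj₂ (r , refl , sr) = inj₂ (r , refl , trans (update-other S _ true r (<⇒≢ (m<n+m r (s≤s z≤n)))) sr)
    td₂ : TotDom n ⟦ S₂ ⟧
    td₂ = deletion-safe n ⟦ S₁ ⟧ ⟦ S₂ ⟧ j td₁ (update-other S₁ j false) (update-same S₁ false j<n)
                        left₁ (inj₂ (update-same S true j+2<n))
    small₂ : Small S₂
    small₂ = td₂ , subst (_≤ k) (sym (suc-injective (trans (∣update-false∣ S₁ s₁j) (∣update-true∣ S sj+2 j+2<n)))) (proj₂ small)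
    agree₂ : Agree S₂ (suc j)
    agree₂ = agree-extend S₂ j (agree-update S₁ j false j ≤-refl (agree-update S _ true j (≤-trans (n≤1+n j) (n≤1+n _)) agree))
                          (trans (update-same S₁ false j<n) (cong not (sym gj)))

  -- S has size k > g n, so it is not irredundant; a deletable vertex u lies
  -- to the right of j, since positions up to j are forced or not deletable.
  shrinkStep : ∀ j S → j < n → Small S → Agree S j → ¬ TotDom n ⟦ update S j false ⟧ → ¬ ∣ S ∣ < k → Progress j S
  shrinkStep j S j<n small agree ¬td′ ∣S∣≮k with deletable-or-irredundant S
  ... | inj₂ irr = contradiction (<-≤-trans (s≤s (irredundant-bound S (proj₁ small) irr)) g<k) ∣S∣≮k
  ... | inj₁ (u , u<n , su , tdu) with <-cmp u j
  ...   | tri< u<j _ _ = contradiction tdu (forced S ⟦ update S u false ⟧ u (λ i i<u → agree i (<-trans i<u u<j))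
                                              (not≡true (trans (sym (agree u u<j)) su)) u<n
                                              (update-other S u false) (update-same S false u<n))
  ...   | tri≈ _ refl _ = contradiction tdu ¬td′
  ...   | tri> _ _ j<u = shrink S′ (step S false u<n (λ e → true≢false (trans (sym su) e)) small small′) small′
                                (agree-update S u false j (<⇒≤ j<u) agree) (≤-reflexive (∣update-false∣ S su))
    where
    S′ : Subset n
    S′ = update S u false
    small′ : Small S′
    small′ = tdu , ≤-trans (n≤1+n _) (≤-trans (≤-reflexive (∣update-false∣ S su)) (proj₂ small))

  progress : ∀ j S → j < n → Small S → Agree S j → Progress j S
  progress j S j<n small agree with ⟦ S ⟧ j in sj | gap n j in gj
  ... | true | false = advance S ε small (agree-extend S j agree (trans sj (cong not (sym gj))))
  ... | false | true = advance S ε small (agree-extend S j agree (trans sj (cong not (sym gj))))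
  ... | false | false = contradiction (proj₁ small) (forced S ⟦ S ⟧ j agree gj j<n (λ _ _ → refl) sj)
  ... | true | true with totDom? n ⟦ update S j false ⟧
  ...   | yes td′ = deleteStep j S j<n small agree sj gj td′
  ...   | no ¬td′ with ∣ S ∣ <? k
  ...     | yes ∣S∣<k = swapStep j S j<n small agree sj gj ¬td′ ∣S∣<k
  ...     | no ∣S∣≮k = shrinkStep j S j<n small agree ¬td′ ∣S∣≮k

  -- Sweep from position j to the end (d positions remain).  At position j
  -- the size of S bounds the number of shrinking steps before an advance.
  sweep : ∀ d j S → j + d ≡ n → Small S → Agree S j → Path S (canonical n)
  sweep zero j S j≡n _ agree = subst (Path S) S≡S* ε
    where
    S≡S* : S ≡ canonical n
    S≡S* = ⟦⟧-injective S _ (λ i i<n →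
             trans (agree i (subst (i <_) (sym (trans (sym (+-identityʳ j)) j≡n)) i<n))
                   (sym (⟦fromFun⟧ n _ i<n)))
  sweep (suc d) j S j+d+1≡n small agree = atPosition ∣ S ∣ S ≤-refl (progress j S j<n small agree)
    where
    j<n : j < n
    j<n = subst (j <_) j+d+1≡n (m<m+n j (s≤s z≤n))
    atPosition : ∀ c S → ∣ S ∣ ≤ c → Progress j S → Path S (canonical n)
    atPosition c S _ (advance S′ path small′ agree′) =
      path ◅◅ sweep d (suc j) S′ (trans (sym (+-suc j d)) j+d+1≡n) small′ agree′
    atPosition zero S ∣S∣≤0 (shrink _ _ _ _ smaller) = contradiction (<-≤-trans smaller ∣S∣≤0) λ ()
    atPosition (suc c) S ∣S∣≤c+1 (shrink S′ path small′ agree′ smaller) =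
      path ◅◅ atPosition c S′ (≤-pred (<-≤-trans smaller ∣S∣≤c+1)) (progress j S′ j<n small′ agree′)

  toCanonical : ∀ S → IsDVertex (P n) k S → Path S (canonical n)
  toCanonical S vertex = sweep n 0 S refl (fromVertex S vertex) (λ i ())
connected : ∀ n k → 2 ≤ n → g n < k → DConnected (P n) k
connected n k 2≤n g<k = (extremal n , TotDom⇒isTDS _ (extremal-TotDom n 2≤n) , ≤-trans (≤-reflexive (∣extremal∣ n)) (<⇒≤ g<k)) ,
                        λ S T vS vT → toCanonical S vS ◅◅ reverse DEdge-sym (toCanonical T vT)
  where open Reconfiguration n k g<k

-- D_1(P_n) has no vertices, hence is not connected.
D₁-disconnected : ∀ n → 1 ≤ n → ¬ DConnected (P n) 1
D₁-disconnected (suc n) _ ((S , tds , ∣S∣≤1) , _) = contradiction (TotDom⇒2≤∣∣ S (isTDS⇒TotDom S tds)) (<⇒≱ (s≤s ∣S∣≤1))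

lookup-ext : ∀ {n} (S T : Subset n) → (∀ w → lookup S w ≡ lookup T w) → S ≡ T
lookup-ext S T eq = trans (sym (tabulate∘lookup S)) (trans (tabulate-cong eq) (tabulate∘lookup T))

∣∣-oneStep-add : ∀ {n} (S T : Subset n) v → lookup S v ≡ false → lookup S v ≢ lookup T v →
                 (∀ w → w ≢ v → lookup S w ≡ lookup T w) → ∣ T ∣ ≡ suc ∣ S ∣
∣∣-oneStep-add (false ∷ S) (y ∷ T) fzero refl differs agrees with y
... | true = cong suc (cong ∣_∣ (sym (lookup-ext S T (λ w → agrees (fsuc w) (λ ())))))
... | false = contradiction refl differs
∣∣-oneStep-add (x ∷ S) (y ∷ T) (fsuc v) absent differs agrees with agrees fzero (λ ())
... | refl with x | ∣∣-oneStep-add S T v absent differs (λ w w≢v → agrees (fsuc w) (λ e → w≢v (fsuc-injective e)))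
...   | true | ∣T∣≡1+∣S∣ = cong suc ∣T∣≡1+∣S∣
...   | false | ∣T∣≡1+∣S∣ = ∣T∣≡1+∣S∣

-- A minimal TDS of size k is an isolated vertex of D_k(G): a neighbour
-- either misses one of its vertices (a proper subset, hence not a TDS) or
-- has one more vertex (size k + 1).
minimal-isolated : ∀ {G k M U} → IsMinimalTDS G M → ∣ M ∣ ≡ k → ¬ DEdge G k M U
minimal-isolated {M = M} {U} (_ , noSmaller) ∣M∣≡k (_ , (tdsU , ∣U∣≤k) , v , differs , agrees) with lookup M v in mv
... | true = noSmaller U (U⊆M , v , lookup⇒[]= v M mv , λ v∈U → differs (sym ([]=⇒lookup v∈U))) tdsU
  where
  U⊆M : U ⊆ M
  U⊆M {x} x∈U with x ≟ᶠ v
  ... | yes refl = contradiction (sym ([]=⇒lookup x∈U)) differs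
  ... | no x≢v = lookup⇒[]= x M (trans (agrees x x≢v) ([]=⇒lookup x∈U))
... | false = contradiction (≤-trans (≤-reflexive (sym (trans (∣∣-oneStep-add M U v mv (λ e → differs (trans (sym mv) e)) agrees) (cong suc ∣M∣≡k)))) ∣U∣≤k) 1+n≰n

allBut : (n : ℕ) → ℕ → Subset n
allBut n x = fromFun n (λ i → not (i ≡ᵇ x))

allBut0-TotDom : ∀ n → 3 ≤ n → TotDom n ⟦ allBut n 0 ⟧
allBut0-TotDom n 3≤n zero _ = ∨-introˡ _ (⟦fromFun⟧ n _ (<-trans (n<1+n 1) 3≤n))
allBut0-TotDom n 3≤n (suc zero) _ = ∨-introˡ _ (⟦fromFun⟧ n _ 3≤n)
allBut0-TotDom n 3≤n (suc (suc u)) v<n = ∨-introʳ _ (⟦fromFun⟧ n _ (<-trans (n<1+n _) v<n))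

allBut2-TotDom : ∀ n → 5 ≤ n → TotDom n ⟦ allBut n 2 ⟧
allBut2-TotDom n 5≤n zero _ = ∨-introˡ _ (⟦fromFun⟧ n _ (≤-trans (m≤m+n 2 3) 5≤n))
allBut2-TotDom n 5≤n (suc zero) _ = ∨-introʳ _ (⟦fromFun⟧ n _ (≤-trans (m≤m+n 1 4) 5≤n))
allBut2-TotDom n 5≤n (suc (suc zero)) _ = ∨-introʳ _ (⟦fromFun⟧ n _ (≤-trans (m≤m+n 2 3) 5≤n))
allBut2-TotDom n 5≤n (suc (suc (suc zero))) _ = ∨-introˡ _ (⟦fromFun⟧ n _ 5≤n)
allBut2-TotDom n 5≤n (suc (suc (suc (suc u)))) v<n = ∨-introʳ _ (⟦fromFun⟧ n _ (<-trans (n<1+n _) v<n))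

-- If deleting a vertex x of the extremal set from the whole path leaves a
-- TDS, an irredundant TDS inside it is a second vertex of D_{g n}.
avoiding : ∀ n x → TotDom n ⟦ allBut n x ⟧ → ⟦ extremal n ⟧ x ≡ true →
           Σ (Subset n) λ T → IsDVertex (P n) (g n) T × T ≢ extremal n
avoiding n x td x∈M with shrinkToIrredundant n (allBut n x) (∣p∣≤n (allBut n x)) td
... | T , tdT , irr , T⊆allBut = T , (TotDom⇒isTDS T tdT , irredundant-bound T tdT irr) , λ T≡M →
  true≢false (trans (sym x∈M) (trans (cong (λ S → ⟦ S ⟧ x) (sym T≡M)) x∉T))
  where
  x∉T : ⟦ T ⟧ x ≡ false
  x∉T = ≢true (λ e → true≢false (trans (sym (T⊆allBut x e)) (⟦fromFun⟧-false n _ x (cong not (≡ᵇ-refl x)))))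
    where
    ≡ᵇ-refl : ∀ m → (m ≡ᵇ m) ≡ true
    ≡ᵇ-refl zero = refl
    ≡ᵇ-refl (suc m) = ≡ᵇ-refl m

extremal-at : ∀ n {o} x → offset n ≡ o → x < n → ⟦ extremal n ⟧ x ≡ block (o + x)
extremal-at n x o≡ x<n = trans (cong (λ S → ⟦ S ⟧ x) (extremal-as n o≡)) (⟦fromFun⟧ n _ x<n)

n≡1-mod3⇒5≤n : ∀ n → 3 ≤ n → n ≢ 4 → mod3 n ≡ 1 → 5 ≤ n
n≡1-mod3⇒5≤n 1 (s≤s ()) _ _
n≡1-mod3⇒5≤n 3 _ _ ()
n≡1-mod3⇒5≤n 4 _ n≢4 _ = contradiction refl n≢4
n≡1-mod3⇒5≤n (suc (suc (suc (suc (suc n))))) _ _ _ = s≤s (s≤s (s≤s (s≤s (s≤s z≤n))))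

-- For n = 3 or n ≥ 5, D_{g n}(P_n) has a vertex other than the extremal set:
-- delete vertex 0 (pattern 110…) or vertex 2 (pattern 011…).
second-vertex : ∀ n → 3 ≤ n → n ≢ 4 → Σ (Subset n) λ T → IsDVertex (P n) (g n) T × T ≢ extremal n
second-vertex n 3≤n n≢4 with offset-cases n
... | inj₁ (o≡0 , _) = avoiding n 0 (allBut0-TotDom n 3≤n) (extremal-at n 0 o≡0 (<-trans (s≤s z≤n) 3≤n))
... | inj₂ (o≡2 , n≡1) = avoiding n 2 (allBut2-TotDom n 5≤n) (extremal-at n 2 o≡2 3≤n)
  where
  5≤n : 5 ≤ n
  5≤n = n≡1-mod3⇒5≤n n 3≤n n≢4 n≡1

-- Hence D_{g n}(P_n) is disconnected: a path from the extremal set to the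
-- second vertex would start with an edge at an isolated vertex.
extremal-disconnected : ∀ n → 3 ≤ n → n ≢ 4 → ¬ DConnected (P n) (g n)
extremal-disconnected n 3≤n n≢4 (_ , conn) with second-vertex n 3≤n n≢4
... | T , vT , T≢M with conn (extremal n) T (proj₁ (extremal-minimal n 2≤n) , ≤-reflexive (∣extremal∣ n)) vT
  where
  2≤n : 2 ≤ n
  2≤n = <-trans (n<1+n 1) 3≤n
...   | ε = T≢M refl
...   | edge ◅ _ = minimal-isolated (extremal-minimal n (<-trans (n<1+n 1) 3≤n)) (∣extremal∣ n) edge

2≤g : ∀ n → 2 ≤ n → 2 ≤ g n
2≤g (suc zero) (s≤s ())
2≤g (suc (suc zero)) _ = ≤-refl
2≤g (suc (suc (suc n))) _ = s≤s (s≤s z≤n)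

d₀-large : ∀ n → 3 ≤ n → n ≢ 4 → IsD0 (P n) (suc (g n))
d₀-large n 3≤n n≢4 = (λ k _ g<k → connected n k 2≤n g<k) , least
  where
  2≤n : 2 ≤ n
  2≤n = <-trans (n<1+n 1) 3≤n
  least : ∀ ℓ → (∀ k → 1 ≤ k → ℓ ≤ k → DConnected (P n) k) → suc (g n) ≤ ℓ
  least ℓ conn with suc (g n) ≤? ℓ
  ... | yes g<ℓ = g<ℓ
  ... | no g≮ℓ = contradiction (conn (g n) (<-trans (s≤s z≤n) (2≤g n 2≤n)) (≤-pred (≰⇒> g≮ℓ)))
                               (extremal-disconnected n 3≤n n≢4)

-- d₀(P_n) = 2 when g n = 2 and the extremal set is the only TDS of size ≤ 2:
-- D_1 is empty, D_2 is a single vertex and D_k is connected for k > 2.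
d₀-small : ∀ n → g n ≡ 2 → 2 ≤ n → (∀ (S : Subset n) → TotDom n ⟦ S ⟧ → ∣ S ∣ ≤ 2 → S ≡ extremal n) → IsD0 (P n) 2
d₀-small n g≡2 2≤n unique = connectedFrom2 , least
  where
  connectedFrom2 : ∀ k → 1 ≤ k → 2 ≤ k → DConnected (P n) k
  connectedFrom2 k _ 2≤k with m≤n⇒m<n∨m≡n 2≤k
  ... | inj₁ 2<k = connected n k 2≤n (subst (_< k) (sym g≡2) 2<k)
  ... | inj₂ refl = (extremal n , TotDom⇒isTDS _ (extremal-TotDom n 2≤n) , ≤-reflexive (trans (∣extremal∣ n) g≡2)) ,
                    λ S T vS vT → subst₂ (Star (DEdge (P n) 2)) (sym (isExtremal S vS)) (sym (isExtremal T vT)) ε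
    where
    isExtremal : ∀ X → IsDVertex (P n) 2 X → X ≡ extremal n
    isExtremal X (tds , ∣X∣≤2) = unique X (isTDS⇒TotDom X tds) ∣X∣≤2
  least : ∀ ℓ → (∀ k → 1 ≤ k → ℓ ≤ k → DConnected (P n) k) → 2 ≤ ℓ
  least ℓ conn with 2 ≤? ℓ
  ... | yes 2≤ℓ = 2≤ℓ
  ... | no 2≰ℓ = contradiction (conn 1 ≤-refl (≤-pred (≰⇒> 2≰ℓ))) (D₁-disconnected n (<-trans (s≤s z≤n) 2≤n))

unique-P₂ : ∀ (S : Subset 2) → TotDom 2 ⟦ S ⟧ → ∣ S ∣ ≤ 2 → S ≡ extremal 2
unique-P₂ (true ∷ true ∷ []) _ _ = refl
unique-P₂ (a ∷ false ∷ []) td _ with td 0 (s≤s z≤n)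
... | ()
unique-P₂ (false ∷ true ∷ []) td _ with td 1 (s≤s (s≤s z≤n))
... | ()

unique-P₄ : ∀ (S : Subset 4) → TotDom 4 ⟦ S ⟧ → ∣ S ∣ ≤ 2 → S ≡ extremal 4
unique-P₄ (false ∷ true ∷ true ∷ false ∷ []) _ _ = refl
unique-P₄ (a ∷ false ∷ c ∷ d ∷ []) td _ with td 0 (s≤s z≤n)
... | ()
unique-P₄ (a ∷ true ∷ false ∷ d ∷ []) td _ with td 3 (s≤s (s≤s (s≤s (s≤s z≤n))))
... | ()
unique-P₄ (true ∷ true ∷ true ∷ d ∷ []) _ (s≤s (s≤s ()))
unique-P₄ (false ∷ true ∷ true ∷ true ∷ []) _ (s≤s (s≤s ()))

theorem3p10 : IsD0 (P 2) 2 × IsUpperTotalDom (P 2) 2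
              × IsD0 (P 4) 2 × IsUpperTotalDom (P 4) 2
              × (∀ n → (n ≡ 3 ⊎ 5 ≤ n) → ∃ λ g → IsUpperTotalDom (P n) g × IsD0 (P n) (suc g))
theorem3p10 =
  d₀-small 2 refl ≤-refl unique-P₂ , upperTotalDom 2 ≤-refl ,
  d₀-small 4 refl 2≤4 unique-P₄ , upperTotalDom 4 2≤4 ,
  λ n n≡3∨5≤n → g n , upperTotalDom n (<-trans (n<1+n 1) (3≤n n≡3∨5≤n)) , d₀-large n (3≤n n≡3∨5≤n) (≢4 n≡3∨5≤n)
  where
  2≤4 : 2 ≤ 4
  2≤4 = s≤s (s≤s z≤n)
  3≤n : ∀ {n} → n ≡ 3 ⊎ 5 ≤ n → 3 ≤ n
  3≤n (inj₁ refl) = ≤-refl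
  3≤n (inj₂ 5≤n) = ≤-trans (m≤m+n 3 2) 5≤n
  ≢4 : ∀ {n} → n ≡ 3 ⊎ 5 ≤ n → n ≢ 4
  ≢4 (inj₁ refl) ()
  ≢4 (inj₂ 5≤n) refl = 1+n≰n 5≤n
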